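{- There exists an infinite family of strings $w$, with lengths $n=|w|$ unbounded over the family, such that $r_B(w^R)-r_B(w)=n/5-1$ for every $w$ in the family (in particular $r_B(w^R)-r_B(w)=\Theta(n)$).
   Context: Strings are over a finite totally ordered alphabet (which may depend on the string), compared lexicographically. For $w=w[1]\cdots w[n]$, $w^R=w[n]\cdots w[1]$. A Lyndon word is a nonempty string strictly smaller than all its other rotations. The Lyndon factorization of $w$ is the unique sequence $x_1,\dots,x_\ell$ of Lyndon words with $w=x_1\cdots x_\ell$ and $x_1\ge x_2\ge\cdots\ge x_\ell$. The $\omega$-order is defined by $x<_\omega y$ iff $x^\omega<y^\omega$ lexicographically, where $x^\omega$ is the infinite periodic string $xxx\cdots$. The bijective Burrows–Wheeler transform ${\tt BBWT}(w)$ is obtained by taking the multiset of all rotations of all the factors $x_1,\dots,x_\ell$ of the Lyndon factorization of $w$, sorting them in $\omega$-order, and concatenating their last characters. $r_B(w)$ is the number of runs (maximal blocks of consecutive equal symbols) of ${\tt BBWT}(w)$. -}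

module Defs where

open import Data.Nat using (ℕ; zero; suc; _+_; _<_; _%_; _≟_; NonZero)
open import Data.List using (List; []; _∷_; length; drop; take; _++_; concat; concatMap; map; upTo; lookup)
open import Data.List.Relation.Binary.Lex.Strict using (Lex-<)
open import Data.List.Relation.Unary.All using (All)
open import Data.List.Relation.Unary.Linked using (Linked)
open import Data.List.Relation.Binary.Permutation.Propositional using (_↭_)
open import Data.Fin using (Fin; fromℕ<)
open import Data.Nat.DivMod using (m%n<n)
open import Data.Product using (Σ; _×_; ∃; ∃-syntax)
open import Data.Sum using (_⊎_)
open import Relation.Binary.PropositionalEquality using (_≡_)
open import Relation.Nullary using (¬_; yes; no)

-- Strings: finite lists of naturals (any finite totally ordered alphabet
-- embeds order-preservingly into ℕ).
Str : Set
Str = List ℕ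

_<ₗ_ : Str → Str → Set
_<ₗ_ = Lex-< _≡_ _<_

rot : ℕ → Str → Str
rot i w = drop i w ++ take i w

Lyndon : Str → Set
Lyndon w = (0 < length w) × (∀ i → 0 < i → i < length w → w <ₗ rot i w)

_≥ₗ_ : Str → Str → Set
x ≥ₗ y = (y ≡ x) ⊎ (y <ₗ x)

IsLyndonFactorization : Str → List Str → Set
IsLyndonFactorization w fs = (concat fs ≡ w) × All Lyndon fs × Linked _≥ₗ_ fs

InfStr : Set
InfStr = ℕ → ℕ

omega : (x : Str) → 0 < length x → InfStr
omega x p i = lookup x (fromℕ< (m%n<n i (length x) {{nz p}}))
  where
  nz : ∀ {n} → 0 < n → NonZero n
  nz {suc n} _ = _

_<∞_ : InfStr → InfStr → Set
a <∞ b = ∃[ k ] ((∀ i → i < k → a i ≡ b i) × (a k < b k))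

NEStr : Set
NEStr = Σ Str (λ x → 0 < length x)

_<ω_ : NEStr → NEStr → Set
(x Data.Product., p) <ω (y Data.Product., q) = omega x p <∞ omega y q

rotations : Str → List Str
rotations x = map (λ i → rot i x) (upTo (length x))

lastChar : Str → List ℕ
lastChar [] = []
lastChar (c ∷ []) = c ∷ []
lastChar (c ∷ d ∷ r) = lastChar (d ∷ r)

_≤ω_ : NEStr → NEStr → Set
u ≤ω v = ¬ (v <ω u)

IsBBWT : Str → Str → Set
IsBBWT w b =
  ∃[ fs ] ∃[ S ]
    ( IsLyndonFactorization w fs
    × (map Data.Product.proj₁ S ↭ concatMap rotations fs)
    × Linked _≤ω_ S
    × (b ≡ concatMap lastChar (map Data.Product.proj₁ S)) )

runsFrom : ℕ → Str → ℕ
runsFrom p [] = 0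
runsFrom p (y ∷ r) with p ≟ y
... | yes _ = runsFrom y r
... | no _ = suc (runsFrom y r)

runs : Str → ℕ
runs [] = 0
runs (x ∷ r) = suc (runsFrom x r)

rB≡ : Str → ℕ → Set
rB≡ w k = ∃[ b ] (IsBBWT w b × runs b ≡ k)

{-# OPTIONS --safe #-}
module Submission where

-- Let w = B₀ B₁ ⋯ B_m with blocks B_i = a_i b_i c_i d_i c_i over letters
-- a₀ < b₀ < c₀ < d₀ < a₁ < ⋯, so n = |w| = 5(m+1).
-- Since a₀ occurs once and is least, w is Lyndon and BBWT(w) is the BWT of w.
-- Its rotations are ordered by their first two letters: inside a block
-- the one at the second c_i (followed by a_{i+1}) comes after the one at c_i d_i,
-- so each c_i c_i (i < m) ends up adjacent in the BWT, which has 4(m+1) + 1 runs.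
-- The reverse factors as (c_i d_i)(c_i)(b_i)(a_i) for i = m, …, 0; sorting the
-- rotations of these factors gives a_i, b_i, c_i, c_i d_i, d_i c_i block by block,
-- so BBWT(w^R) = w, which has 5(m+1) runs.

open import Defs
open import Data.Nat using (ℕ; zero; suc; _+_; _*_; _≤_; _<_; _≟_; z<s; s<s; s≤s)
open import Data.Nat.Properties
  using (+-identityʳ; +-suc; +-comm; n<1+n; n≤1+n; m≤m*n; ≤-trans; <-trans; <-irrefl; <-asym;
         <⇒≢; >⇒≢)
open import Data.Nat.Tactic.RingSolver using (solve-∀)
open import Data.List
  using (List; []; _∷_; _++_; _∷ʳ_; length; reverse; drop; take; concat; concatMap; map; head;
         upTo; downFrom)
open import Data.List.Properties
  using (length-++; take++drop≡id; ++-assoc; ++-identityʳ; map-++; map-∘; concatMap-++; reverse-++;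
         upTo-∷ʳ)
open import Data.List.Relation.Binary.Lex.Core using (this; next; halt)
open import Data.List.Relation.Unary.All using (All; []; _∷_)
open import Data.List.Relation.Unary.Linked using (Linked; []; [-]; _∷_; _∷′_)
open import Data.List.Relation.Binary.Permutation.Propositional
  using (_↭_; ↭-refl; ↭-prep; ↭-swap; ↭-trans; module PermutationReasoning)
open import Data.List.Relation.Binary.Permutation.Propositional.Properties
  using (map⁺; ++-comm; ++⁺ˡ; ++⁺ʳ; ↭-reverse)
open import Data.Maybe using (just)
open import Data.Maybe.Relation.Binary.Connected using (Connected; just; just-nothing)
open import Data.Product using (_×_; _,_; proj₁; ∃-syntax)
open import Data.Sum using (inj₂)
open import Relation.Nullary using (yes; no; contradiction)
open import Relation.Binary.PropositionalEquality
  using (_≡_; _≢_; refl; sym; trans; cong; cong₂; subst; module ≡-Reasoning)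

range : ℕ → ℕ → List ℕ
range i zero = []
range i (suc n) = i ∷ range (suc i) n

range-suc : ∀ i n → range i (suc n) ≡ range i n ∷ʳ (i + n)
range-suc i zero = cong (_∷ []) (sym (+-identityʳ i))
range-suc i (suc n) =
  cong (i ∷_) (trans (range-suc (suc i) n) (cong (range (suc i) n ∷ʳ_) (sym (+-suc i n))))

upTo≡range : ∀ n → upTo n ≡ range 0 n
upTo≡range zero = refl
upTo≡range (suc n) = begin
  upTo (suc n)    ≡⟨ upTo-∷ʳ n ⟨
  upTo n ∷ʳ n     ≡⟨ cong (_∷ʳ n) (upTo≡range n) ⟩
  range 0 n ∷ʳ n  ≡⟨ range-suc 0 n ⟨
  range 0 (suc n) ∎
  where open ≡-Reasoning

concatMap-range-suc : ∀ {A : Set} (f : ℕ → List A) i n →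
                      concatMap f (range i (suc n)) ≡ concatMap f (range i n) ++ f (i + n)
concatMap-range-suc f i n = begin
  concatMap f (range i (suc n))               ≡⟨ cong (concatMap f) (range-suc i n) ⟩
  concatMap f (range i n ∷ʳ (i + n))          ≡⟨ concatMap-++ f (range i n) (i + n ∷ []) ⟩
  concatMap f (range i n) ++ f (i + n) ++ []  ≡⟨ cong (concatMap f (range i n) ++_) (++-identityʳ _) ⟩
  concatMap f (range i n) ++ f (i + n)        ∎
  where open ≡-Reasoning

drop-++-length : ∀ {A : Set} (xs ys : List A) n → drop (length xs + n) (xs ++ ys) ≡ drop n ys
drop-++-length []       ys n = refl
drop-++-length (x ∷ xs) ys n = drop-++-length xs ys n

take-++-length : ∀ {A : Set} (xs ys : List A) n → take (length xs + n) (xs ++ ys) ≡ xs ++ take n ys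
take-++-length []       ys n = refl
take-++-length (x ∷ xs) ys n = cong (x ∷_) (take-++-length xs ys n)

rot-++ : ∀ (xs ys : Str) n → rot (length xs + n) (xs ++ ys) ≡ drop n ys ++ xs ++ take n ys
rot-++ xs ys n = cong₂ _++_ (drop-++-length xs ys n) (take-++-length xs ys n)

length-rot : ∀ n (w : Str) → length (rot n w) ≡ length w
length-rot n w = begin
  length (drop n w ++ take n w)         ≡⟨ length-++ (drop n w) ⟩
  length (drop n w) + length (take n w) ≡⟨ +-comm (length (drop n w)) _ ⟩
  length (take n w) + length (drop n w) ≡⟨ length-++ (take n w) ⟨
  length (take n w ++ drop n w)         ≡⟨ cong length (take++drop≡id n w) ⟩
  length w                              ∎
  where open ≡-Reasoning

rotation : (w : Str) → 0 < length w → ℕ → NEStr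
rotation w w-nonempty n = rot n w , subst (0 <_) (sym (length-rot n w)) w-nonempty

lastChar-++ : ∀ xs {y ys} → lastChar (xs ++ y ∷ ys) ≡ lastChar (y ∷ ys)
lastChar-++ []            = refl
lastChar-++ (x ∷ [])      = refl
lastChar-++ (x ∷ x₂ ∷ xs) = lastChar-++ (x₂ ∷ xs)

minimal-head⇒Lyndon : ∀ {x xs} → All (x <_) xs → Lyndon (x ∷ xs)
minimal-head⇒Lyndon {x} {xs} x<xs = z<s , smaller-than-rot
  where
  below-drop : ∀ {ys zs} i → All (x <_) ys → i < length ys → (x ∷ xs) <ₗ (drop i ys ++ zs)
  below-drop zero    (x<y ∷ _)   _         = this x<y
  below-drop (suc i) (_ ∷ x<ys) (s≤s i<n) = below-drop i x<ys i<n

  smaller-than-rot : ∀ i → 0 < i → i < length (x ∷ xs) → (x ∷ xs) <ₗ rot i (x ∷ xs)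
  smaller-than-rot zero    ()  _
  smaller-than-rot (suc i) _  (s≤s i<n) = below-drop i x<xs i<n

-- The compared strings are explicit arguments: their length proofs cannot be recovered
-- from a goal in which ≤ω has unfolded to ω-powers.
≤ω-head : ∀ ((x , p) (y , q) : NEStr) {u v xs ys} →
          x ≡ u ∷ xs → y ≡ v ∷ ys → u < v → (x , p) ≤ω (y , q)
≤ω-head _ _ refl refl u<v (zero  , _     , v<u) = <-asym u<v v<u
≤ω-head _ _ refl refl u<v (suc k , agree , _)   = <⇒≢ u<v (sym (agree 0 z<s))

≤ω-by-second : ∀ ((x , p) (y , q) : NEStr) →
               omega x p 0 ≡ omega y q 0 → omega x p 1 < omega y q 1 → (x , p) ≤ω (y , q)
≤ω-by-second _ _ same lt (zero        , _     , gt) = <-irrefl (sym same) gt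
≤ω-by-second _ _ same lt (suc zero    , _     , gt) = <-asym lt gt
≤ω-by-second _ _ same lt (suc (suc k) , agree , _)  = <⇒≢ lt (sym (agree 1 (s<s z<s)))

≤ω-second : ∀ ((x , p) (y , q) : NEStr) {u v v₂ xs ys} →
            x ≡ u ∷ v ∷ xs → y ≡ u ∷ v₂ ∷ ys → v < v₂ → (x , p) ≤ω (y , q)
≤ω-second x y refl refl = ≤ω-by-second x y refl

runsFrom-≢ : ∀ {x y ys n} → x ≢ y → runsFrom y ys ≡ n → runsFrom x (y ∷ ys) ≡ suc n
runsFrom-≢ {x} {y} x≢y eq with x ≟ y
... | yes x≡y = contradiction x≡y x≢y
... | no _    = cong suc eq

runsFrom-≡ : ∀ {x ys n} → runsFrom x ys ≡ n → runsFrom x (x ∷ ys) ≡ n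
runsFrom-≡ {x} eq with x ≟ x
... | yes _   = eq
... | no x≢x = contradiction refl x≢x

a b c d : ℕ → ℕ
a i = i * 4
b i = 1 + i * 4
c i = 2 + i * 4
d i = 3 + i * 4

a<b : ∀ i → a i < b i
a<b i = n<1+n (a i)

b<c : ∀ i → b i < c i
b<c i = n<1+n (b i)

c<d : ∀ i → c i < d i
c<d i = n<1+n (c i)

d<a : ∀ i → d i < a (suc i)
d<a i = n<1+n (d i)

b<d : ∀ i → b i < d i
b<d i = <-trans (b<c i) (c<d i)

c<a : ∀ i → c i < a (suc i)
c<a i = <-trans (c<d i) (d<a i)

block : ℕ → Str
block i = a i ∷ b i ∷ c i ∷ d i ∷ c i ∷ []

blocks : ℕ → ℕ → Str
blocks i n = concatMap block (range i n)

word : ℕ → Str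
word m = blocks 0 (suc m)

length-blocks : ∀ i n → length (blocks i n) ≡ n * 5
length-blocks i zero = refl
length-blocks i (suc n) = cong (5 +_) (length-blocks (suc i) n)

lastChar-blocks : ∀ i n → lastChar (blocks i (suc n)) ≡ c (i + n) ∷ []
lastChar-blocks i n = trans (cong lastChar (concatMap-range-suc block i n)) (lastChar-++ (blocks i n))

blocks-positive : ∀ i n → All (0 <_) (blocks (suc i) n)
blocks-positive i zero = []
blocks-positive i (suc n) = z<s ∷ z<s ∷ z<s ∷ z<s ∷ z<s ∷ blocks-positive (suc i) n

word-Lyndon : ∀ m → Lyndon (word m)
word-Lyndon m = minimal-head⇒Lyndon (z<s ∷ z<s ∷ z<s ∷ z<s ∷ blocks-positive 0 m)

runsFrom-blocks : ∀ i n {x} → x ≢ a i → runsFrom x (blocks i n) ≡ n * 5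
runsFrom-blocks i zero    x≢a = refl
runsFrom-blocks i (suc n) x≢a =
  runsFrom-≢ x≢a (runsFrom-≢ (<⇒≢ (a<b i)) (runsFrom-≢ (<⇒≢ (b<c i))
    (runsFrom-≢ (<⇒≢ (c<d i)) (runsFrom-≢ (>⇒≢ (c<d i))
      (runsFrom-blocks (suc i) n (<⇒≢ (c<a i)))))))

-- runs w and runsFrom 1 w agree since w starts with a₀ = 0 ≠ 1.
runs-word : ∀ m → runs (word m) ≡ suc m * 5
runs-word m = runsFrom-blocks 0 (suc m) {1} λ ()

blockFactors : ℕ → List Str
blockFactors i = (c i ∷ d i ∷ []) ∷ (c i ∷ []) ∷ (b i ∷ []) ∷ (a i ∷ []) ∷ []

reverseFactors : ℕ → List Str
reverseFactors n = concatMap blockFactors (downFrom n)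

concat-reverseFactors : ∀ n → concat (reverseFactors n) ≡ reverse (blocks 0 n)
concat-reverseFactors zero = refl
concat-reverseFactors (suc n) = begin
  reverse (block n) ++ concat (reverseFactors n) ≡⟨ cong (reverse (block n) ++_) (concat-reverseFactors n) ⟩
  reverse (block n) ++ reverse (blocks 0 n)      ≡⟨ reverse-++ (blocks 0 n) (block n) ⟨
  reverse (blocks 0 n ++ block n)                ≡⟨ cong reverse (concatMap-range-suc block 0 n) ⟨
  reverse (blocks 0 (suc n))                     ∎
  where open ≡-Reasoning

reverseFactors-Lyndon : ∀ n → All Lyndon (reverseFactors n)
reverseFactors-Lyndon zero = []
reverseFactors-Lyndon (suc n) =
  minimal-head⇒Lyndon (c<d n ∷ []) ∷ minimal-head⇒Lyndon [] ∷ minimal-head⇒Lyndon []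
    ∷ minimal-head⇒Lyndon [] ∷ reverseFactors-Lyndon n

reverseFactors-nonincreasing : ∀ n → Linked _≥ₗ_ (reverseFactors n)
reverseFactors-nonincreasing zero = []
reverseFactors-nonincreasing (suc n) =
  inj₂ (next refl halt) ∷ inj₂ (this (b<c n)) ∷ inj₂ (this (a<b n))
    ∷ (a≥next n ∷′ reverseFactors-nonincreasing n)
  where
  a≥next : ∀ n → Connected _≥ₗ_ (just (a n ∷ [])) (head (reverseFactors n))
  a≥next zero    = just-nothing
  a≥next (suc n) = just (inj₂ (this (c<a n)))

single : ℕ → NEStr
single x = x ∷ [] , z<s

pair : ℕ → ℕ → NEStr
pair x y = x ∷ y ∷ [] , z<s

blockRotations : ℕ → List NEStr
blockRotations i =
  single (a i) ∷ single (b i) ∷ single (c i) ∷ pair (c i) (d i) ∷ pair (d i) (c i) ∷ []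

blockRotations-↭ : ∀ i → map proj₁ (blockRotations i) ↭ concatMap rotations (blockFactors i)
blockRotations-↭ i =
  ↭-trans (++-comm (singletons a b c) (cd ∷ dc ∷ []))
          (++⁺ˡ (cd ∷ dc ∷ []) (↭-reverse (singletons c b a)))
  where
  cd dc : Str
  cd = c i ∷ d i ∷ []
  dc = d i ∷ c i ∷ []
  singletons : (ℕ → ℕ) → (ℕ → ℕ) → (ℕ → ℕ) → List Str
  singletons x y z = (x i ∷ []) ∷ (y i ∷ []) ∷ (z i ∷ []) ∷ []

sortedReverseRotations : ℕ → ℕ → List NEStr
sortedReverseRotations i n = concatMap blockRotations (range i n)

sortedReverseRotations-sorted : ∀ i n → Linked _≤ω_ (sortedReverseRotations i n)
sortedReverseRotations-sorted i zero = []
sortedReverseRotations-sorted i (suc n) =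
  ≤ω-head (single (a i)) (single (b i)) refl refl (a<b i)
    ∷ ≤ω-head (single (b i)) (single (c i)) refl refl (b<c i)
    ∷ ≤ω-by-second (single (c i)) (pair (c i) (d i)) refl (c<d i)
    ∷ ≤ω-head (pair (c i) (d i)) (pair (d i) (c i)) refl refl (c<d i)
    ∷ (d≤next n ∷′ sortedReverseRotations-sorted (suc i) n)
  where
  d≤next : ∀ n → Connected _≤ω_ (just (pair (d i) (c i)))
                              (head (sortedReverseRotations (suc i) n))
  d≤next zero    = just-nothing
  d≤next (suc n) = just (≤ω-head (pair (d i) (c i)) (single (a (suc i))) refl refl (d<a i))

sortedReverseRotations-↭ : ∀ n →
  map proj₁ (sortedReverseRotations 0 n) ↭ concatMap rotations (reverseFactors n)
sortedReverseRotations-↭ zero = ↭-refl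
sortedReverseRotations-↭ (suc n) = begin
  map proj₁ (sortedReverseRotations 0 (suc n))
    ≡⟨ cong (map proj₁) (concatMap-range-suc blockRotations 0 n) ⟩
  map proj₁ (sortedReverseRotations 0 n ++ blockRotations n)
    ≡⟨ map-++ proj₁ (sortedReverseRotations 0 n) (blockRotations n) ⟩
  map proj₁ (sortedReverseRotations 0 n) ++ map proj₁ (blockRotations n)
    ↭⟨ ++⁺ʳ (map proj₁ (blockRotations n)) (sortedReverseRotations-↭ n) ⟩
  concatMap rotations (reverseFactors n) ++ map proj₁ (blockRotations n)
    ↭⟨ ++-comm (concatMap rotations (reverseFactors n)) (map proj₁ (blockRotations n)) ⟩
  map proj₁ (blockRotations n) ++ concatMap rotations (reverseFactors n)
    ↭⟨ ++⁺ʳ (concatMap rotations (reverseFactors n)) (blockRotations-↭ n) ⟩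
  concatMap rotations (reverseFactors (suc n))
    ∎
  where open PermutationReasoning

lastChars-sortedReverseRotations : ∀ i n →
  concatMap lastChar (map proj₁ (sortedReverseRotations i n)) ≡ blocks i n
lastChars-sortedReverseRotations i zero    = refl
lastChars-sortedReverseRotations i (suc n) =
  cong (block i ++_) (lastChars-sortedReverseRotations (suc i) n)

reverse-word-BBWT : ∀ m → IsBBWT (reverse (word m)) (word m)
reverse-word-BBWT m =
  reverseFactors (suc m) , sortedReverseRotations 0 (suc m)
  , (concat-reverseFactors (suc m) , reverseFactors-Lyndon (suc m)
     , reverseFactors-nonincreasing (suc m))
  , sortedReverseRotations-↭ (suc m) , sortedReverseRotations-sorted 0 (suc m)
  , sym (lastChars-sortedReverseRotations 0 (suc m))

-- In the last
-- block (r = 0) the rotation at the second c_i wraps around to a₀ < d_i, so it precedes the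
-- one at c_i d_i instead of following it.
sortedPositions : ℕ → ℕ → List ℕ
sortedPositions i zero    = i * 5 ∷ 1 + i * 5 ∷ 4 + i * 5 ∷ 2 + i * 5 ∷ 3 + i * 5 ∷ []
sortedPositions i (suc r) =
  i * 5 ∷ 1 + i * 5 ∷ 2 + i * 5 ∷ 4 + i * 5 ∷ 3 + i * 5 ∷ sortedPositions (suc i) r

sortedPositions-↭ : ∀ i r → sortedPositions i r ↭ range (i * 5) (suc r * 5)
sortedPositions-↭ i zero =
  ↭-prep _ (↭-prep _ (↭-trans (↭-swap _ _ ↭-refl) (↭-prep _ (↭-swap _ _ ↭-refl))))
sortedPositions-↭ i (suc r) =
  ↭-prep _ (↭-prep _ (↭-prep _ (↭-swap _ _ (sortedPositions-↭ (suc i) r))))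

bwtTail : ℕ → ℕ → Str
bwtTail i zero    = a i ∷ d i ∷ b i ∷ c i ∷ []
bwtTail i (suc r) = a i ∷ b i ∷ d i ∷ c i ∷ c i ∷ bwtTail (suc i) r

runsFrom-bwtTail : ∀ i r {x} → x ≢ a i → runsFrom x (bwtTail i r) ≡ suc r * 4
runsFrom-bwtTail i zero x≢a =
  runsFrom-≢ x≢a (runsFrom-≢ (<⇒≢ (<-trans (a<b i) (b<d i))) (runsFrom-≢ (>⇒≢ (b<d i))
    (runsFrom-≢ (<⇒≢ (b<c i)) refl)))
runsFrom-bwtTail i (suc r) x≢a =
  runsFrom-≢ x≢a (runsFrom-≢ (<⇒≢ (a<b i)) (runsFrom-≢ (<⇒≢ (b<d i))
    (runsFrom-≢ (>⇒≢ (c<d i)) (runsFrom-≡ {c i} {bwtTail (suc i) r}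
      (runsFrom-bwtTail (suc i) r (<⇒≢ (c<a i)))))))

module _ (m : ℕ) where

  ρ : ℕ → ℕ → NEStr
  ρ i j = rotation (word m) z<s (j + i * 5)

  sortedRotations : ℕ → ℕ → List NEStr
  sortedRotations i r = map (rotation (word m) z<s) (sortedPositions i r)

  Split : ℕ → ℕ → Set
  Split i r = word m ≡ blocks 0 i ++ blocks i (suc r)

  split-step : ∀ i r → Split i (suc r) → Split (suc i) r
  split-step i r split = begin
    word m                               ≡⟨ split ⟩
    blocks 0 i ++ block i ++ later       ≡⟨ ++-assoc (blocks 0 i) (block i) later ⟨
    (blocks 0 i ++ block i) ++ later     ≡⟨ cong (_++ later) (concatMap-range-suc block 0 i) ⟨
    blocks 0 (suc i) ++ later            ∎
    where
    open ≡-Reasoning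
    later : Str
    later = blocks (suc i) (suc r)

  module AtBlock (i r : ℕ) (split : Split i r) where

    rot≡ : ∀ j → rot (j + i * 5) (word m)
                 ≡ drop j (blocks i (suc r)) ++ blocks 0 i ++ take j (blocks i (suc r))
    rot≡ j = begin
      rot (j + i * 5) (word m)
        ≡⟨ cong₂ rot (trans (+-comm j (i * 5)) (cong (_+ j) (sym (length-blocks 0 i)))) split ⟩
      rot (length (blocks 0 i) + j) (blocks 0 i ++ blocks i (suc r))
        ≡⟨ rot-++ (blocks 0 i) (blocks i (suc r)) j ⟩
      drop j (blocks i (suc r)) ++ blocks 0 i ++ take j (blocks i (suc r))
        ∎
      where open ≡-Reasoning

    lastChar-rot≡ : ∀ j → lastChar (rot (suc j + i * 5) (word m))
                          ≡ lastChar (take (suc j) (blocks i (suc r)))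
    lastChar-rot≡ j = begin
      lastChar (rot (suc j + i * 5) (word m))      ≡⟨ cong lastChar (rot≡ (suc j)) ⟩
      lastChar (dropped ++ blocks 0 i ++ taken)    ≡⟨ cong lastChar (++-assoc dropped _ taken) ⟨
      lastChar ((dropped ++ blocks 0 i) ++ taken)  ≡⟨ lastChar-++ (dropped ++ blocks 0 i) ⟩
      lastChar taken                               ∎
      where
      open ≡-Reasoning
      dropped taken : Str
      dropped = drop (suc j) (blocks i (suc r))
      taken = take (suc j) (blocks i (suc r))

  -- The clauses differ only in whether the a₀ after the last c is read from B₀ ⋯ B_{i-1}
  -- or, when i = 0, from B₀ itself.
  wrap-≤ω : ∀ i → Split i zero → ρ i 4 ≤ω ρ i 2
  wrap-≤ω zero    split = ≤ω-second (ρ 0 4) (ρ 0 2) (rot≡ 4) (rot≡ 2) z<s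
    where open AtBlock zero zero split
  wrap-≤ω (suc i) split = ≤ω-second (ρ (suc i) 4) (ρ (suc i) 2) (rot≡ 4) (rot≡ 2) z<s
    where open AtBlock (suc i) zero split

  last-block-sorted : ∀ i → Split i zero → Linked _≤ω_ (sortedRotations i zero)
  last-block-sorted i split =
    ≤ω-head (ρ i 0) (ρ i 1) (rot≡ 0) (rot≡ 1) (a<b i)
      ∷ ≤ω-head (ρ i 1) (ρ i 4) (rot≡ 1) (rot≡ 4) (b<c i)
      ∷ wrap-≤ω i split
      ∷ ≤ω-head (ρ i 2) (ρ i 3) (rot≡ 2) (rot≡ 3) (c<d i)
      ∷ [-]
    where open AtBlock i zero split

  middle-block-sorted : ∀ i r {xs} → Split i (suc r) → Linked _≤ω_ (ρ i 5 ∷ xs) →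
                        Linked _≤ω_ (ρ i 0 ∷ ρ i 1 ∷ ρ i 2 ∷ ρ i 4 ∷ ρ i 3 ∷ ρ i 5 ∷ xs)
  middle-block-sorted i r split later =
    ≤ω-head (ρ i 0) (ρ i 1) (rot≡ 0) (rot≡ 1) (a<b i)
      ∷ ≤ω-head (ρ i 1) (ρ i 2) (rot≡ 1) (rot≡ 2) (b<c i)
      ∷ ≤ω-second (ρ i 2) (ρ i 4) (rot≡ 2) (rot≡ 4) (d<a i)
      ∷ ≤ω-head (ρ i 4) (ρ i 3) (rot≡ 4) (rot≡ 3) (c<d i)
      ∷ ≤ω-head (ρ i 3) (ρ i 5) (rot≡ 3) (rot≡ 5) (d<a i)
      ∷ later
    where open AtBlock i (suc r) split

  sortedRotations-sorted : ∀ i r → Split i r → Linked _≤ω_ (sortedRotations i r)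
  sortedRotations-sorted i zero split = last-block-sorted i split
  sortedRotations-sorted i (suc zero) split =
    middle-block-sorted i zero split (sortedRotations-sorted (suc i) zero (split-step i zero split))
  sortedRotations-sorted i (suc (suc r)) split =
    middle-block-sorted i (suc r) split
      (sortedRotations-sorted (suc i) (suc r) (split-step i (suc r) split))

  sortedRotations-↭ : map proj₁ (sortedRotations 0 m) ↭ concatMap rotations (word m ∷ [])
  sortedRotations-↭ = begin
    map proj₁ (sortedRotations 0 m)       ≡⟨ map-∘ (sortedPositions 0 m) ⟨
    map rotateWord (sortedPositions 0 m)  ↭⟨ map⁺ rotateWord (sortedPositions-↭ 0 m) ⟩
    map rotateWord (range 0 (suc m * 5))  ≡⟨ cong (map rotateWord) positions ⟨
    rotations (word m)                    ≡⟨ ++-identityʳ (rotations (word m)) ⟨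
    rotations (word m) ++ []              ∎
    where
    open PermutationReasoning
    rotateWord : ℕ → Str
    rotateWord p = rot p (word m)
    positions : upTo (length (word m)) ≡ range 0 (suc m * 5)
    positions = trans (cong upTo (length-blocks 0 (suc m))) (upTo≡range (suc m * 5))

  lastChars-sortedRotations : ∀ i r → Split i r →
    concatMap lastChar (map proj₁ (sortedRotations i r)) ≡ lastChar (rot (i * 5) (word m)) ++ bwtTail i r
  lastChars-sortedRotations i zero split =
    cong (lastChar (rot (i * 5) (word m)) ++_)
      (cong₂ _++_ (lastChar-rot≡ 0) (cong₂ _++_ (lastChar-rot≡ 3)
        (cong₂ _++_ (lastChar-rot≡ 1) (cong₂ _++_ (lastChar-rot≡ 2) refl))))
    where open AtBlock i zero split
  lastChars-sortedRotations i (suc r) split =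
    cong (lastChar (rot (i * 5) (word m)) ++_)
      (cong₂ _++_ (lastChar-rot≡ 0) (cong₂ _++_ (lastChar-rot≡ 1)
        (cong₂ _++_ (lastChar-rot≡ 3) (cong₂ _++_ (lastChar-rot≡ 2) later))))
    where
    open AtBlock i (suc r) split
    later : concatMap lastChar (map proj₁ (sortedRotations (suc i) r)) ≡ c i ∷ bwtTail (suc i) r
    later = trans (lastChars-sortedRotations (suc i) r (split-step i r split))
                  (cong (_++ bwtTail (suc i) r) (lastChar-rot≡ 4))

  word-BBWT : IsBBWT (word m) (concatMap lastChar (map proj₁ (sortedRotations 0 m)))
  word-BBWT =
    word m ∷ [] , sortedRotations 0 m , (++-identityʳ (word m) , word-Lyndon m ∷ [] , [-])
    , sortedRotations-↭ , sortedRotations-sorted 0 m refl , refl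

  runs-word-BBWT : runs (concatMap lastChar (map proj₁ (sortedRotations 0 m))) ≡ suc (suc m * 4)
  runs-word-BBWT = begin
    runs (concatMap lastChar (map proj₁ (sortedRotations 0 m)))
      ≡⟨ cong runs (lastChars-sortedRotations 0 m refl) ⟩
    runs (lastChar (word m ++ []) ++ bwtTail 0 m)
      ≡⟨ cong (λ w → runs (lastChar w ++ bwtTail 0 m)) (++-identityʳ (word m)) ⟩
    runs (lastChar (word m) ++ bwtTail 0 m)
      ≡⟨ cong (λ l → runs (l ++ bwtTail 0 m)) (lastChar-blocks 0 m) ⟩
    suc (runsFrom (c m) (bwtTail 0 m))
      ≡⟨ cong suc (runsFrom-bwtTail 0 m λ ()) ⟩
    suc (suc m * 4)
      ∎
    where open ≡-Reasoning

rB-word : ∀ m → rB≡ (word m) (suc (suc m * 4))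
rB-word m = _ , word-BBWT m , runs-word-BBWT m

rB-reverse-word : ∀ m → rB≡ (reverse (word m)) (suc m * 5)
rB-reverse-word m = word m , reverse-word-BBWT m , runs-word m

proposition3p9 : ∀ (N : ℕ) → ∃[ w ] ∃[ r ] ∃[ rR ]
    ( (N ≤ length w)
    × rB≡ w r
    × rB≡ (reverse w) rR
    × (5 * rR + 5 ≡ 5 * r + length w) )
proposition3p9 N =
  word N , suc (suc N * 4) , suc N * 5
  , subst (N ≤_) (sym length-word) (≤-trans (n≤1+n N) (m≤m*n (suc N) 5))
  , rB-word N
  , rB-reverse-word N
  , trans (runs-identity N) (cong (5 * suc (suc N * 4) +_) (sym length-word))
  where
  length-word : length (word N) ≡ suc N * 5
  length-word = length-blocks 0 (suc N)
  runs-identity : ∀ n → 5 * (suc n * 5) + 5 ≡ 5 * suc (suc n * 4) + suc n * 5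
  runs-identity = solve-∀
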